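{- Let $n\ge 1$ and let $\mathcal{A}^{\mathrm{bd}}$ be the cluster algebra of type $A_n$ with boundary frozen variables, i.e. the cluster algebra of a convex $(n+3)$-gon whose cluster variables $x_\gamma$ are indexed by the diagonals $\gamma$, whose frozen variables $x_\zeta$ are indexed by the $n+3$ sides $\zeta$, and whose seeds are $\Sigma_T=\{x_\tau:\tau\in T\}\cup\{x_\zeta:\zeta \text{ a side}\}$ for triangulations $T$. Then for every seed $\Sigma_T$ and every cluster variable $x_\gamma$, the Newton polytope of the Laurent polynomial expressing $x_\gamma$ in the variables of $\Sigma_T$ is saturated and empty.
   Context: For a Laurent polynomial $f=\sum_{a\in\mathbb{Z}^d}c_a x^a$, the support of $f$ is $\{a:c_a\neq 0\}$ and the Newton polytope $N(f)\subset\mathbb{R}^d$ is the convex hull of the support. $N(f)$ is saturated if every lattice point of $N(f)$ lies in the support of $f$, and empty if every lattice point of $N(f)$ is a vertex of $N(f)$. In the cluster algebra described, two seeds $\Sigma_T,\Sigma_{T'}$ with $T'=T\setminus\{\tau\}\cup\{\tau'\}$ (a diagonal flip in a quadrilateral $ABCD$ with $\tau=AC$, $\tau'=BD$) are related by the Ptolemy exchange relation $x_{AC}x_{BD}=x_{AB}x_{CD}+x_{AD}x_{BC}$, where $x$ of a side of the polygon is the corresponding frozen variable. By the Laurent phenomenon each $x_\gamma$ is a Laurent polynomial in the variables of $\Sigma_T$; its Newton polytope lives in $\mathbb{R}^{T}\times\mathbb{R}^{\{\text{sides}\}}$. -}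

module Defs where

open import Data.Nat as ℕ using (ℕ; suc)
open import Data.Fin using (Fin; toℕ; zero)
open import Data.Fin.Properties using (all?)
open import Data.Integer as ℤ using (ℤ; +_)
open import Data.Rational as ℚ using (ℚ; 0ℚ; 1ℚ)
open import Data.Bool using (Bool; true; false; if_then_else_)
open import Data.List using (List; []; _∷_; _++_; concatMap; map; foldr)
open import Data.List.Relation.Unary.All using (All)
open import Data.Product using (_×_; _,_; ∃; Σ-syntax; ∃-syntax)
open import Data.Sum using (_⊎_)
open import Relation.Nullary using (¬_; Dec; yes; no)
open import Relation.Nullary.Decidable using (⌊_⌋)
open import Relation.Binary.PropositionalEquality using (_≡_; _≢_)

-- Laurent polynomials over ℤ in variables indexed by pairs (i , j) of
-- vertices of a polygon with N vertices (only pairs with i < j are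
-- used as variables: the arc/side between vertices i and j).

Exp : ℕ → Set
Exp N = Fin N → Fin N → ℤ

expEq : ∀ {N} → Exp N → Exp N → Bool
expEq a b = ⌊ all? (λ i → all? (λ j → a i j ℤ.≟ b i j)) ⌋

Laurent : ℕ → Set
Laurent N = List (ℤ × Exp N)

coeff : ∀ {N} → Laurent N → Exp N → ℤ
coeff [] a = + 0
coeff ((c , b) ∷ f) a = if expEq b a then c ℤ.+ coeff f a else coeff f a

_≈L_ : ∀ {N} → Laurent N → Laurent N → Set
f ≈L g = ∀ a → coeff f a ≡ coeff g a

_+L_ : ∀ {N} → Laurent N → Laurent N → Laurent N
f +L g = f ++ g

_*L_ : ∀ {N} → Laurent N → Laurent N → Laurent N
f *L g = concatMap (λ { (c , a) → map (λ { (d , b) → (c ℤ.* d , λ i j → a i j ℤ.+ b i j) }) g }) f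

var : ∀ {N} → Fin N → Fin N → Laurent N
var {N} i j = (+ 1 , e) ∷ []
  where
  e : Exp N
  e k l = if ⌊ toℕ k ℕ.≟ toℕ i ⌋ then (if ⌊ toℕ l ℕ.≟ toℕ j ⌋ then + 1 else + 0) else + 0

Supp : ∀ {N} → Laurent N → Exp N → Set
Supp f a = coeff f a ≢ + 0

toℚ : ℤ → ℚ
toℚ z = z ℚ./ 1

-- p lies in the convex hull of the set P ⊆ ℤ^{N×N} (a rational convex
-- combination of finitely many points of P; for lattice points p and a
-- finite set P this is the same as lying in the real convex hull).
InConv : ∀ {N} → (Exp N → Set) → Exp N → Set
InConv {N} P p =
  Σ[ ws ∈ List (ℚ × Exp N) ]
    All (λ { (w , a) → (0ℚ ℚ.≤ w) × P a }) ws
    × foldr (λ { (w , a) s → w ℚ.+ s }) 0ℚ ws ≡ 1ℚ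
    × (∀ i j → foldr (λ { (w , a) s → w ℚ.* toℚ (a i j) ℚ.+ s }) 0ℚ ws ≡ toℚ (p i j))

InNewton : ∀ {N} → Laurent N → Exp N → Set
InNewton f p = InConv (Supp f) p

IsVertex : ∀ {N} → Laurent N → Exp N → Set
IsVertex f p = Supp f p × ¬ InConv (λ a → Supp f a × ¬ (∀ i j → a i j ≡ p i j)) p

Saturated : ∀ {N} → Laurent N → Set
Saturated f = ∀ p → InNewton f p → Supp f p

Empty : ∀ {N} → Laurent N → Set
Empty f = ∀ p → InNewton f p → IsVertex f p

-- The convex N-gon with vertices 0,1,…,N-1 in cyclic order.

_<F_ : ∀ {N} → Fin N → Fin N → Set
i <F j = toℕ i ℕ.< toℕ j

IsSide : ∀ {N} → Fin N → Fin N → Set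
IsSide {N} i j = (suc (toℕ i) ≡ toℕ j) ⊎ (toℕ i ≡ 0 × suc (toℕ j) ≡ N)

IsDiagonal : ∀ {N} → Fin N → Fin N → Set
IsDiagonal i j = i <F j × ¬ IsSide i j

Cross : ∀ {N} → Fin N → Fin N → Fin N → Fin N → Set
Cross i j k l = (i <F k × k <F j × j <F l) ⊎ (k <F i × i <F l × l <F j)

record Triangulation (N : ℕ) : Set where
  field
    inT        : Fin N → Fin N → Bool
    diag       : ∀ i j → inT i j ≡ true → IsDiagonal i j
    noncross   : ∀ i j k l → inT i j ≡ true → inT k l ≡ true → ¬ Cross i j k l
    maximal    : ∀ i j → IsDiagonal i j → inT i j ≡ false →
                 ∃[ k ] ∃[ l ] (inT k l ≡ true × Cross i j k l)
open Triangulation public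

InSeed : ∀ {N} → Triangulation N → Fin N → Fin N → Set
InSeed T i j = i <F j × (inT T i j ≡ true ⊎ IsSide i j)

-- L expresses all cluster and frozen variables x_{ij} (i<j) as Laurent
-- polynomials in the variables of Σ_T: seed variables map to themselves,
-- and all exchange (Ptolemy) relations hold.  For vertices A<B<C<D
-- (hence in cyclic order) the quadrilateral ABCD has diagonals AC, BD.
IsExpansion : ∀ {N} → Triangulation N → (Fin N → Fin N → Laurent N) → Set
IsExpansion {N} T L =
  (∀ i j → InSeed T i j → L i j ≈L var i j)
  × (∀ (A B C D : Fin N) → A <F B → B <F C → C <F D →
       (L A C *L L B D) ≈L ((L A B *L L C D) +L (L A D *L L B C)))

{-# OPTIONS --safe #-}
module Submission where

-- Induct on the set of vertices involved in a diagonal x y: its endpoints and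
-- the endpoints of the diagonals of T that it crosses.  If x y is not an edge
-- of T, let x B D be the triangle of T that x y enters at x, so that B D
-- crosses x y.  The Ptolemy relation on x, B, y, D (up to orientation) reads
-- x_xy x_BD = x_xB x_yD + x_xD x_By, so the support of x_xy is covered by a
-- translate of supp x_yD and one of supp x_By, and x is involved in neither
-- y D nor B y.  The invariant is that the support is rigid (a convex
-- combination of its points that is a lattice point p is concentrated on p,
-- i.e. the Newton polytope is saturated and empty) and only uses variables
-- joining involved vertices.  Hence x_xB occurs in neither x_yD nor x_By, and
-- the two translates lie on the hyperplanes a_xB = 1 and a_xB = 0.  The
-- barycentre has an integral a_xB-coordinate in [0 , 1], so all the weight
-- sits on one translate, whose rigidity concludes.

open import Defs
open import Data.Nat as ℕ using (ℕ; suc; _<_; _∸_; _+_; _≥_)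
open import Data.Nat.Properties
  using (_<?_; <-cmp; <-irrefl; <-trans; <-≤-trans; ≤-<-trans; ≤-refl; <⇒≤; <⇒≱; ≮⇒≥; ≤∧≢⇒<; m<1+n⇒m≤n;
         m≤m+n; +-monoˡ-<; +-monoʳ-<; ∸-monoˡ-<; ∸-monoʳ-<)
open import Data.Nat.Induction using (<-wellFounded)
import Data.Nat.Coprimality as Coprime
open import Data.Fin as Fin using (Fin; toℕ; fromℕ; fromℕ<; inject₁)
open import Data.Fin.Properties using (all?; any?; toℕ-injective; toℕ<n; toℕ-fromℕ; toℕ-fromℕ<; toℕ-inject₁)
open import Data.Fin.Subset using (Subset; _∈_; _⊂_)
open import Data.Fin.Subset.Induction using (⊂-wellFounded)
open import Data.Integer as ℤ using (ℤ; +_)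
import Data.Integer.Properties as ℤ
open import Data.Integer.Tactic.RingSolver using (solve-∀)
open import Data.Rational as ℚ using (ℚ; mkℚ; 0ℚ; 1ℚ; toℚᵘ)
import Data.Rational.Properties as ℚ
open import Data.Rational.Solver using (module +-*-Solver)
import Data.Rational.Unnormalised as ℚᵘ
import Data.Rational.Unnormalised.Properties as ℚᵘ
open import Data.Bool as Bool using (true; false; if_then_else_)
open import Data.Bool.Properties using (¬-not)
open import Data.List using (List; []; _∷_; map; foldr)
open import Data.List.Relation.Unary.All as All using (All; []; _∷_)
import Data.List.Relation.Unary.All.Properties as All
open import Data.Vec using (tabulate)
open import Data.Vec.Properties using (lookup∘tabulate; lookup⇒[]=; []=⇒lookup)
open import Data.Product as Product using (Σ; _×_; _,_; proj₁; proj₂; ∃; Σ-syntax; ∃-syntax)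
open import Data.Sum as Sum using (_⊎_; inj₁; inj₂)
open import Data.Empty using (⊥)
open import Function using (id; _∘_; _⇔_; mk⇔)
open import Induction.WellFounded using (Acc; acc)
open import Level using (0ℓ)
open import Relation.Nullary using (¬_; Dec; yes; no; contradiction)
open import Relation.Nullary.Decidable
  using (does; isYes; ⌊_⌋; _×-dec_; _⊎-dec_; does-⇔; isYes≗does; dec-true; dec-false; decidable-stable)
open import Relation.Unary using (Pred; _⊆_)
open import Relation.Binary.Core using (Rel; _⇒_)
open import Relation.Binary.Definitions using (tri<; tri≈; tri>)
open import Relation.Binary.PropositionalEquality

private
  variable
    N : ℕ
    A A′ : Set
    i j k l : Fin N

infixl 6 _⊕_ _⊖_
infix 4 _≐_

_⊕_ _⊖_ : Exp N → Exp N → Exp N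
(a ⊕ b) i j = a i j ℤ.+ b i j
(a ⊖ b) i j = a i j ℤ.- b i j

_≐_ : Exp N → Exp N → Set
a ≐ b = ∀ i j → a i j ≡ b i j

_≐?_ : (a b : Exp N) → Dec (a ≐ b)
a ≐? b = all? λ i → all? λ j → a i j ℤ.≟ b i j

⊖-⊕-cancel : (a t : Exp N) → (a ⊖ t) ⊕ t ≐ a
⊖-⊕-cancel a t i j = [x-y]+y≡x (a i j) (t i j)
  where
  [x-y]+y≡x : ∀ x y → (x ℤ.- y) ℤ.+ y ≡ x
  [x-y]+y≡x = solve-∀

⊖-cancelʳ : {a b t : Exp N} → a ⊖ t ≐ b ⊖ t → a ≐ b
⊖-cancelʳ {a = a} {b} {t} eq i j = begin
  a i j                       ≡⟨ ⊖-⊕-cancel a t i j ⟨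
  (a i j ℤ.- t i j) ℤ.+ t i j ≡⟨ cong (ℤ._+ t i j) (eq i j) ⟩
  (b i j ℤ.- t i j) ℤ.+ t i j ≡⟨ ⊖-⊕-cancel b t i j ⟩
  b i j                       ∎
  where open ≡-Reasoning

⊕-≐⇔≐-⊖ : (b c a : Exp N) → b ⊕ c ≐ a ⇔ c ≐ a ⊖ b
⊕-≐⇔≐-⊖ b c a = mk⇔ (λ eq i j → trans (sym ([x+y]-x≡y (b i j) (c i j))) (cong (ℤ._- b i j) (eq i j)))
                     (λ eq i j → trans (cong (λ z → b i j ℤ.+ z) (eq i j)) (x+[z-x]≡z (b i j) (a i j)))
  where
  [x+y]-x≡y : ∀ x y → (x ℤ.+ y) ℤ.- x ≡ y
  [x+y]-x≡y = solve-∀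
  x+[z-x]≡z : ∀ x z → x ℤ.+ (z ℤ.- x) ≡ z
  x+[z-x]≡z = solve-∀

≐-⊖-swap : (b c a : Exp N) → b ≐ a ⊖ c → c ≐ a ⊖ b
≐-⊖-swap b c a eq i j = trans (sym (x-[x-y]≡y (a i j) (c i j))) (cong (λ z → a i j ℤ.- z) (sym (eq i j)))
  where
  x-[x-y]≡y : ∀ x y → x ℤ.- (x ℤ.- y) ≡ y
  x-[x-y]≡y = solve-∀

-- var i j is definitionally (+ 1 , basis i j) ∷ [].
basis : Fin N → Fin N → Exp N
basis i j k l = if ⌊ toℕ k ℕ.≟ toℕ i ⌋ then (if ⌊ toℕ l ℕ.≟ toℕ j ⌋ then + 1 else + 0) else + 0

basis-diag : (i j : Fin N) → basis i j i j ≡ + 1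
basis-diag i j with toℕ i ℕ.≟ toℕ i | toℕ j ℕ.≟ toℕ j
... | yes _  | yes _  = refl
... | yes _  | no j≢j = contradiction refl j≢j
... | no i≢i | _      = contradiction refl i≢i

basis-offˡ : {i j k : Fin N} → k ≢ i → ∀ l → basis i j k l ≡ + 0
basis-offˡ {i = i} {k = k} k≢i l with toℕ k ℕ.≟ toℕ i
... | yes k≡i = contradiction (toℕ-injective k≡i) k≢i
... | no _    = refl

basis-offʳ : {i j l : Fin N} → l ≢ j → ∀ k → basis i j k l ≡ + 0
basis-offʳ {i = i} {j} {l} l≢j k with toℕ k ℕ.≟ toℕ i | toℕ l ℕ.≟ toℕ j
... | yes _ | yes l≡j = contradiction (toℕ-injective l≡j) l≢j
... | yes _ | no _    = refl
... | no _  | _       = refl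

basis-nonzero : {i j k l : Fin N} → basis i j k l ≢ + 0 → k ≡ i × l ≡ j
basis-nonzero {i = i} {j} {k} {l} nz with toℕ k ℕ.≟ toℕ i | toℕ l ℕ.≟ toℕ j
... | yes k≡i | yes l≡j = toℕ-injective k≡i , toℕ-injective l≡j
... | yes _   | no _    = contradiction refl nz
... | no _    | _       = contradiction refl nz

VerticesIn : (Fin N → Set) → Exp N → Set
VerticesIn V a = ∀ k l → a k l ≢ + 0 → V k × V l

VerticesIn-basis : {V : Fin N → Set} {i j : Fin N} → V i → V j → VerticesIn V (basis i j)
VerticesIn-basis {i = i} {j} Vi Vj k l nz with refl , refl ← basis-nonzero {i = i} {j} {k} {l} nz = Vi , Vj

VerticesIn-cong : {V : Fin N → Set} {a b : Exp N} → a ≐ b → VerticesIn V b → VerticesIn V a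
VerticesIn-cong a≐b in-b k l nz = in-b k l (λ b≡0 → nz (trans (a≐b k l) b≡0))

VerticesIn-⊆ : {V W : Fin N → Set} {a : Exp N} → V ⊆ W → VerticesIn V a → VerticesIn W a
VerticesIn-⊆ V⊆W in-V k l nz = Product.map V⊆W V⊆W (in-V k l nz)

VerticesIn-⊕ : {V : Fin N → Set} {a b : Exp N} → VerticesIn V a → VerticesIn V b → VerticesIn V (a ⊕ b)
VerticesIn-⊕ {a = a} {b} in-a in-b k l nz with b k l ℤ.≟ + 0
... | yes b≡0 = in-a k l (λ a≡0 → nz (cong₂ ℤ._+_ a≡0 b≡0))
... | no b≢0  = in-b k l b≢0

VerticesIn-⊖ : {V : Fin N → Set} {a b : Exp N} → VerticesIn V a → VerticesIn V b → VerticesIn V (a ⊖ b)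
VerticesIn-⊖ {a = a} {b} in-a in-b k l nz with b k l ℤ.≟ + 0
... | yes b≡0 = in-a k l (λ a≡0 → nz (cong₂ ℤ._-_ a≡0 b≡0))
... | no b≢0  = in-b k l b≢0

VerticesIn-zero : {V : Fin N → Set} {a : Exp N} → VerticesIn V a → ∀ k l → ¬ V k ⊎ ¬ V l → a k l ≡ + 0
VerticesIn-zero in-V k l outside = decidable-stable (_ ℤ.≟ + 0) λ nz →
  Sum.[ (λ ¬Vk → ¬Vk (proj₁ (in-V k l nz))) , (λ ¬Vl → ¬Vl (proj₂ (in-V k l nz))) ]′ outside

expEq-cong : {a b c d : Exp N} → a ≐ b ⇔ c ≐ d → expEq a b ≡ expEq c d
expEq-cong {a = a} {b} {c} {d} a≐b⇔c≐d = begin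
  isYes (a ≐? b) ≡⟨ isYes≗does (a ≐? b) ⟩
  does (a ≐? b)  ≡⟨ does-⇔ a≐b⇔c≐d (a ≐? b) (c ≐? d) ⟩
  does (c ≐? d)  ≡⟨ isYes≗does (c ≐? d) ⟨
  isYes (c ≐? d) ∎
  where open ≡-Reasoning

expEq-congʳ : (b : Exp N) {a a′ : Exp N} → a ≐ a′ → expEq b a ≡ expEq b a′
expEq-congʳ b a≐a′ = expEq-cong (mk⇔ (λ eq i j → trans (eq i j) (a≐a′ i j))
                                      (λ eq i j → trans (eq i j) (sym (a≐a′ i j))))

expEq-⊕ : (b c a : Exp N) → expEq (b ⊕ c) a ≡ expEq c (a ⊖ b)
expEq-⊕ b c a = expEq-cong (⊕-≐⇔≐-⊖ b c a)

expEq-⊖-swap : (b c a : Exp N) → expEq b (a ⊖ c) ≡ expEq c (a ⊖ b)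
expEq-⊖-swap b c a = expEq-cong (mk⇔ (≐-⊖-swap b c a) (≐-⊖-swap c b a))

expEq-false : {a b : Exp N} → ¬ a ≐ b → expEq a b ≡ false
expEq-false {a = a} {b} a≉b = trans (isYes≗does (a ≐? b)) (dec-false (a ≐? b) a≉b)

coeff-cong : (f : Laurent N) {a a′ : Exp N} → a ≐ a′ → coeff f a ≡ coeff f a′
coeff-cong [] _ = refl
coeff-cong ((c , b) ∷ f) a≐a′ rewrite expEq-congʳ b a≐a′ | coeff-cong f a≐a′ = refl

coeff-+L : (f g : Laurent N) (a : Exp N) → coeff (f +L g) a ≡ coeff f a ℤ.+ coeff g a
coeff-+L [] g a = sym (ℤ.+-identityˡ _)
coeff-+L ((c , b) ∷ f) g a with expEq b a
... | true  = trans (cong (λ z → c ℤ.+ z) (coeff-+L f g a)) (sym (ℤ.+-assoc c _ _))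
... | false = coeff-+L f g a

+L-congʳ : (f : Laurent N) {g g′ : Laurent N} → g ≈L g′ → (f +L g) ≈L (f +L g′)
+L-congʳ f {g} {g′} g≈g′ a = begin
  coeff (f +L g) a            ≡⟨ coeff-+L f g a ⟩
  coeff f a ℤ.+ coeff g a     ≡⟨ cong (λ z → coeff f a ℤ.+ z) (g≈g′ a) ⟩
  coeff f a ℤ.+ coeff g′ a    ≡⟨ coeff-+L f g′ a ⟨
  coeff (f +L g′) a           ∎
  where open ≡-Reasoning

coeff-∷-*L : (c : ℤ) (b : Exp N) (f g : Laurent N) (a : Exp N) →
             coeff (((c , b) ∷ f) *L g) a ≡ c ℤ.* coeff g (a ⊖ b) ℤ.+ coeff (f *L g) a
coeff-∷-*L c b f g a = trans (coeff-+L (map scale g) (f *L g) a)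
                             (cong (ℤ._+ coeff (f *L g) a) (coeff-scale g))
  where
  scale : ℤ × Exp _ → ℤ × Exp _
  scale (d , b′) = (c ℤ.* d , b ⊕ b′)
  coeff-scale : ∀ g → coeff (map scale g) a ≡ c ℤ.* coeff g (a ⊖ b)
  coeff-scale [] = sym (ℤ.*-zeroʳ c)
  coeff-scale ((d , b′) ∷ g) rewrite expEq-⊕ b b′ a with expEq b′ (a ⊖ b)
  ... | true  = trans (cong (λ z → c ℤ.* d ℤ.+ z) (coeff-scale g)) (sym (ℤ.*-distribˡ-+ c d _))
  ... | false = coeff-scale g

*L-zeroʳ : (f : Laurent N) → (f *L []) ≈L []
*L-zeroʳ [] a = refl
*L-zeroʳ ((c , b) ∷ f) a = begin
  coeff (((c , b) ∷ f) *L []) a   ≡⟨ coeff-∷-*L c b f [] a ⟩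
  c ℤ.* + 0 ℤ.+ coeff (f *L []) a ≡⟨ cong₂ ℤ._+_ (ℤ.*-zeroʳ c) (*L-zeroʳ f a) ⟩
  + 0                             ∎
  where open ≡-Reasoning

*L-congʳ : (f : Laurent N) {g g′ : Laurent N} → g ≈L g′ → (f *L g) ≈L (f *L g′)
*L-congʳ [] _ a = refl
*L-congʳ ((c , b) ∷ f) {g} {g′} g≈g′ a = begin
  coeff (((c , b) ∷ f) *L g) a                 ≡⟨ coeff-∷-*L c b f g a ⟩
  c ℤ.* coeff g (a ⊖ b) ℤ.+ coeff (f *L g) a
    ≡⟨ cong₂ (λ x y → c ℤ.* x ℤ.+ y) (g≈g′ (a ⊖ b)) (*L-congʳ f g≈g′ a) ⟩
  c ℤ.* coeff g′ (a ⊖ b) ℤ.+ coeff (f *L g′) a ≡⟨ coeff-∷-*L c b f g′ a ⟨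
  coeff (((c , b) ∷ f) *L g′) a                ∎
  where open ≡-Reasoning

*L-distribˡ-+L : (f g h : Laurent N) → (f *L (g +L h)) ≈L ((f *L g) +L (f *L h))
*L-distribˡ-+L [] g h a = refl
*L-distribˡ-+L ((c , b) ∷ f) g h a = begin
  coeff (((c , b) ∷ f) *L (g +L h)) a
    ≡⟨ coeff-∷-*L c b f (g +L h) a ⟩
  c ℤ.* coeff (g +L h) (a ⊖ b) ℤ.+ coeff (f *L (g +L h)) a
    ≡⟨ cong₂ (λ x y → c ℤ.* x ℤ.+ y) (coeff-+L g h (a ⊖ b))
             (trans (*L-distribˡ-+L f g h a) (coeff-+L (f *L g) (f *L h) a)) ⟩
  c ℤ.* (coeff g (a ⊖ b) ℤ.+ coeff h (a ⊖ b)) ℤ.+ (coeff (f *L g) a ℤ.+ coeff (f *L h) a)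
    ≡⟨ interchange c _ _ _ _ ⟩
  (c ℤ.* coeff g (a ⊖ b) ℤ.+ coeff (f *L g) a) ℤ.+ (c ℤ.* coeff h (a ⊖ b) ℤ.+ coeff (f *L h) a)
    ≡⟨ cong₂ ℤ._+_ (coeff-∷-*L c b f g a) (coeff-∷-*L c b f h a) ⟨
  coeff (((c , b) ∷ f) *L g) a ℤ.+ coeff (((c , b) ∷ f) *L h) a
    ≡⟨ coeff-+L (((c , b) ∷ f) *L g) (((c , b) ∷ f) *L h) a ⟨
  coeff ((((c , b) ∷ f) *L g) +L (((c , b) ∷ f) *L h)) a ∎
  where
  open ≡-Reasoning
  interchange : ∀ c x y u v → c ℤ.* (x ℤ.+ y) ℤ.+ (u ℤ.+ v) ≡ (c ℤ.* x ℤ.+ u) ℤ.+ (c ℤ.* y ℤ.+ v)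
  interchange = solve-∀

coeff-*L-monomial : (f : Laurent N) (c : ℤ) (b a : Exp N) →
                    coeff (f *L ((c , b) ∷ [])) a ≡ coeff f (a ⊖ b) ℤ.* c
coeff-*L-monomial [] c b a = refl
coeff-*L-monomial ((d , b′) ∷ f) c b a
  rewrite coeff-∷-*L d b′ f ((c , b) ∷ []) a | expEq-⊖-swap b b′ a | coeff-*L-monomial f c b a
  with expEq b′ (a ⊖ b)
... | true  = distrib d c (coeff f (a ⊖ b))
  where
  distrib : ∀ d c r → d ℤ.* (c ℤ.+ + 0) ℤ.+ r ℤ.* c ≡ (d ℤ.+ r) ℤ.* c
  distrib = solve-∀
... | false = trans (cong (ℤ._+ coeff f (a ⊖ b) ℤ.* c) (ℤ.*-zeroʳ d)) (ℤ.+-identityˡ _)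

*L-comm : (f g : Laurent N) → (f *L g) ≈L (g *L f)
*L-comm [] g a = sym (*L-zeroʳ g a)
*L-comm ((c , b) ∷ f) g a = begin
  coeff (((c , b) ∷ f) *L g) a                       ≡⟨ coeff-∷-*L c b f g a ⟩
  c ℤ.* coeff g (a ⊖ b) ℤ.+ coeff (f *L g) a         ≡⟨ cong₂ ℤ._+_ (ℤ.*-comm c _) (*L-comm f g a) ⟩
  coeff g (a ⊖ b) ℤ.* c ℤ.+ coeff (g *L f) a         ≡⟨ cong (ℤ._+ coeff (g *L f) a) (coeff-*L-monomial g c b a) ⟨
  coeff (g *L ((c , b) ∷ [])) a ℤ.+ coeff (g *L f) a ≡⟨ coeff-+L (g *L ((c , b) ∷ [])) (g *L f) a ⟨
  coeff ((g *L ((c , b) ∷ [])) +L (g *L f)) a        ≡⟨ *L-distribˡ-+L g ((c , b) ∷ []) f a ⟨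
  coeff (g *L ((c , b) ∷ f)) a                       ∎
  where open ≡-Reasoning

coeff-*L-varʳ : (f : Laurent N) {g : Laurent N} {i j : Fin N} → g ≈L var i j →
                ∀ a → coeff (f *L g) a ≡ coeff f (a ⊖ basis i j)
coeff-*L-varʳ f {i = i} {j} g≈x a =
  trans (*L-congʳ f g≈x a) (trans (coeff-*L-monomial f (+ 1) (basis i j) a) (ℤ.*-identityʳ _))

coeff-*L-varˡ : (f g : Laurent N) {i j : Fin N} → f ≈L var i j →
                ∀ a → coeff (f *L g) a ≡ coeff g (a ⊖ basis i j)
coeff-*L-varˡ f g f≈x a = trans (*L-comm f g a) (coeff-*L-varʳ g f≈x a)

Supp-var : {i j : Fin N} {a : Exp N} → Supp (var i j) a → a ≐ basis i j
Supp-var {i = i} {j} {a} a∈supp k l = sym (basis≐a k l)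
  where
  basis≐a : basis i j ≐ a
  basis≐a = decidable-stable (basis i j ≐? a)
    (λ b≉a → a∈supp (cong (λ t → if t then + 1 ℤ.+ + 0 else + 0) (expEq-false b≉a)))

coeff-exchange : (f h h₁ g₁ h₂ g₂ : Laurent N) {i j i₁ j₁ i₂ j₂ : Fin N} →
                 (f *L h) ≈L ((h₁ *L g₁) +L (h₂ *L g₂)) →
                 h ≈L var i j → h₁ ≈L var i₁ j₁ → h₂ ≈L var i₂ j₂ → ∀ a →
                 coeff f a ≡ coeff g₁ (a ⊖ (basis i₁ j₁ ⊖ basis i j)) ℤ.+ coeff g₂ (a ⊖ (basis i₂ j₂ ⊖ basis i j))
coeff-exchange f h h₁ g₁ h₂ g₂ {i} {j} {i₁} {j₁} {i₂} {j₂} exchange h≈x h₁≈x h₂≈x a = begin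
  coeff f a                                       ≡⟨ coeff-cong f (λ k l → x≡[x+y]-y (a k l) (e k l)) ⟩
  coeff f ((a ⊕ e) ⊖ e)                           ≡⟨ coeff-*L-varʳ f h≈x (a ⊕ e) ⟨
  coeff (f *L h) (a ⊕ e)                          ≡⟨ exchange (a ⊕ e) ⟩
  coeff ((h₁ *L g₁) +L (h₂ *L g₂)) (a ⊕ e)        ≡⟨ coeff-+L (h₁ *L g₁) (h₂ *L g₂) (a ⊕ e) ⟩
  coeff (h₁ *L g₁) (a ⊕ e) ℤ.+ coeff (h₂ *L g₂) (a ⊕ e)
    ≡⟨ cong₂ ℤ._+_ (coeff-*L-varˡ h₁ g₁ h₁≈x (a ⊕ e)) (coeff-*L-varˡ h₂ g₂ h₂≈x (a ⊕ e)) ⟩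
  coeff g₁ ((a ⊕ e) ⊖ basis i₁ j₁) ℤ.+ coeff g₂ ((a ⊕ e) ⊖ basis i₂ j₂)
    ≡⟨ cong₂ ℤ._+_ (coeff-cong g₁ (λ k l → [x+y]-z≡x-[z-y] (a k l) (e k l) _))
                   (coeff-cong g₂ (λ k l → [x+y]-z≡x-[z-y] (a k l) (e k l) _)) ⟩
  coeff g₁ (a ⊖ (basis i₁ j₁ ⊖ e)) ℤ.+ coeff g₂ (a ⊖ (basis i₂ j₂ ⊖ e)) ∎
  where
  open ≡-Reasoning
  e : Exp _
  e = basis i j
  x≡[x+y]-y : ∀ x y → x ≡ (x ℤ.+ y) ℤ.- y
  x≡[x+y]-y = solve-∀
  [x+y]-z≡x-[z-y] : ∀ x y z → (x ℤ.+ y) ℤ.- z ≡ x ℤ.- (z ℤ.- y)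
  [x+y]-z≡x-[z-y] = solve-∀

Supp-exchange : (f h h₁ g₁ h₂ g₂ : Laurent N) {i j i₁ j₁ i₂ j₂ : Fin N} →
                (f *L h) ≈L ((h₁ *L g₁) +L (h₂ *L g₂)) →
                h ≈L var i j → h₁ ≈L var i₁ j₁ → h₂ ≈L var i₂ j₂ → ∀ {a} → Supp f a →
                Supp g₁ (a ⊖ (basis i₁ j₁ ⊖ basis i j)) ⊎ Supp g₂ (a ⊖ (basis i₂ j₂ ⊖ basis i j))
Supp-exchange f h h₁ g₁ h₂ g₂ {i} {j} {i₁} {j₁} exchange h≈x h₁≈x h₂≈x {a} a∈supp
  with coeff g₁ (a ⊖ (basis i₁ j₁ ⊖ basis i j)) ℤ.≟ + 0
... | no c₁≢0  = inj₁ c₁≢0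
... | yes c₁≡0 = inj₂ λ c₂≡0 →
  a∈supp (trans (coeff-exchange f h h₁ g₁ h₂ g₂ exchange h≈x h₁≈x h₂≈x a) (cong₂ ℤ._+_ c₁≡0 c₂≡0))

-- Convex combinations of lattice points

toℚ≡mkℚ : ∀ z → toℚ z ≡ mkℚ z 0 (Coprime.sym (Coprime.1-coprimeTo ℤ.∣ z ∣))
toℚ≡mkℚ z = ℚ.fromℚᵘ-toℚᵘ (mkℚ z 0 _)

toℚ-injective : ∀ {x y} → toℚ x ≡ toℚ y → x ≡ y
toℚ-injective {x} {y} eq = begin
  x              ≡⟨ cong ℚ.↥_ (toℚ≡mkℚ x) ⟨
  ℚ.↥ (toℚ x)    ≡⟨ cong ℚ.↥_ eq ⟩
  ℚ.↥ (toℚ y)    ≡⟨ cong ℚ.↥_ (toℚ≡mkℚ y) ⟩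
  y              ∎
  where open ≡-Reasoning

toℚ-cancel-≤ : ∀ {x y} → toℚ x ℚ.≤ toℚ y → x ℤ.≤ y
toℚ-cancel-≤ {x} {y} le rewrite toℚ≡mkℚ x | toℚ≡mkℚ y =
  subst₂ ℤ._≤_ (ℤ.*-identityʳ x) (ℤ.*-identityʳ y) (ℚ.drop-*≤* le)

toℚ-homo-‿ : ∀ x y → toℚ (x ℤ.- y) ≡ toℚ x ℚ.- toℚ y
toℚ-homo-‿ x y = ℚ.toℚᵘ-injective (begin
  toℚᵘ (toℚ (x ℤ.- y))                 ≡⟨ cong toℚᵘ (toℚ≡mkℚ (x ℤ.- y)) ⟩
  ℚᵘ.mkℚᵘ (x ℤ.- y) 0                  ≈⟨ ℚᵘ.*≡* (cross-multiplied x y) ⟩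
  ℚᵘ.mkℚᵘ x 0 ℚᵘ.- ℚᵘ.mkℚᵘ y 0
    ≡⟨ cong₂ (λ p q → p ℚᵘ.- q) (cong toℚᵘ (toℚ≡mkℚ x)) (cong toℚᵘ (toℚ≡mkℚ y)) ⟨
  toℚᵘ (toℚ x) ℚᵘ.- toℚᵘ (toℚ y)       ≈⟨ ℚᵘ.+-congʳ (toℚᵘ (toℚ x)) (ℚ.toℚᵘ-homo‿- (toℚ y)) ⟨
  toℚᵘ (toℚ x) ℚᵘ.+ toℚᵘ (ℚ.- toℚ y)   ≈⟨ ℚ.toℚᵘ-homo-+ (toℚ x) (ℚ.- toℚ y) ⟨
  toℚᵘ (toℚ x ℚ.- toℚ y)               ∎)
  where
  open ℚᵘ.≃-Reasoning
  cross-multiplied : ∀ x y → (x ℤ.- y) ℤ.* + 1 ≡ (x ℤ.* + 1 ℤ.+ ℤ.- y ℤ.* + 1) ℤ.* + 1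
  cross-multiplied = solve-∀

∑ : List A → (A → ℚ) → ℚ
∑ xs F = foldr (λ x s → F x ℚ.+ s) 0ℚ xs

∑-cong : (xs : List A) {F G : A → ℚ} → All (λ x → F x ≡ G x) xs → ∑ xs F ≡ ∑ xs G
∑-cong [] [] = refl
∑-cong (x ∷ xs) (eq ∷ eqs) = cong₂ ℚ._+_ eq (∑-cong xs eqs)

∑-map : (h : A → A′) (xs : List A) (F : A′ → ℚ) → ∑ (map h xs) F ≡ ∑ xs (F ∘ h)
∑-map h [] F = refl
∑-map h (x ∷ xs) F = cong (F (h x) ℚ.+_) (∑-map h xs F)

∑-‿ : (xs : List A) (F G : A → ℚ) → ∑ xs (λ x → F x ℚ.- G x) ≡ ∑ xs F ℚ.- ∑ xs G
∑-‿ [] F G = refl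
∑-‿ (x ∷ xs) F G = trans (cong (F x ℚ.- G x ℚ.+_) (∑-‿ xs F G)) (interchange (F x) (G x) (∑ xs F) (∑ xs G))
  where
  open +-*-Solver
  interchange : ∀ a b c d → (a ℚ.- b) ℚ.+ (c ℚ.- d) ≡ (a ℚ.+ c) ℚ.- (b ℚ.+ d)
  interchange = solve 4 (λ a b c d → (a :- b) :+ (c :- d) := (a :+ c) :- (b :+ d)) refl

∑-*ʳ : (xs : List A) (F : A → ℚ) (c : ℚ) → ∑ xs (λ x → F x ℚ.* c) ≡ ∑ xs F ℚ.* c
∑-*ʳ [] F c = sym (ℚ.*-zeroˡ c)
∑-*ʳ (x ∷ xs) F c = trans (cong (F x ℚ.* c ℚ.+_) (∑-*ʳ xs F c)) (sym (ℚ.*-distribʳ-+ c (F x) (∑ xs F)))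

∑-mono-≤ : (xs : List A) {F G : A → ℚ} → All (λ x → F x ℚ.≤ G x) xs → ∑ xs F ℚ.≤ ∑ xs G
∑-mono-≤ [] [] = ℚ.≤-refl
∑-mono-≤ (x ∷ xs) (le ∷ les) = ℚ.+-mono-≤ le (∑-mono-≤ xs les)

∑-nonNeg : (xs : List A) {F : A → ℚ} → All (λ x → 0ℚ ℚ.≤ F x) xs → 0ℚ ℚ.≤ ∑ xs F
∑-nonNeg xs {F} nonneg = subst (ℚ._≤ ∑ xs F) (∑-zero xs) (∑-mono-≤ xs nonneg)
  where
  ∑-zero : (xs : List A) → ∑ xs (λ _ → 0ℚ) ≡ 0ℚ
  ∑-zero [] = refl
  ∑-zero (_ ∷ xs) = trans (ℚ.+-identityˡ _) (∑-zero xs)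

∑-nonNeg-≡0 : (xs : List A) {F : A → ℚ} → All (λ x → 0ℚ ℚ.≤ F x) xs → ∑ xs F ≡ 0ℚ →
              All (λ x → F x ≡ 0ℚ) xs
∑-nonNeg-≡0 [] [] _ = []
∑-nonNeg-≡0 (x ∷ xs) {F} (0≤Fx ∷ 0≤F) sum≡0 =
  nonNeg+nonNeg≡0⇒≡0 0≤Fx 0≤rest sum≡0 ∷
  ∑-nonNeg-≡0 xs 0≤F (nonNeg+nonNeg≡0⇒≡0 0≤rest 0≤Fx (trans (ℚ.+-comm (∑ xs F) (F x)) sum≡0))
  where
  0≤rest : 0ℚ ℚ.≤ ∑ xs F
  0≤rest = ∑-nonNeg xs 0≤F
  nonNeg+nonNeg≡0⇒≡0 : ∀ {p q} → 0ℚ ℚ.≤ p → 0ℚ ℚ.≤ q → p ℚ.+ q ≡ 0ℚ → p ≡ 0ℚ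
  nonNeg+nonNeg≡0⇒≡0 {p} {q} 0≤p 0≤q p+q≡0 =
    ℚ.≤-antisym (subst₂ ℚ._≤_ (ℚ.+-identityʳ p) p+q≡0 (ℚ.+-monoʳ-≤ p 0≤q)) 0≤p

Weighted : ℕ → Set
Weighted N = List (ℚ × Exp N)

mass : Weighted N → ℚ
mass ws = ∑ ws proj₁

moment : Weighted N → Fin N → Fin N → ℚ
moment ws i j = ∑ ws (λ (w , a) → w ℚ.* toℚ (a i j))

Barycentre : Weighted N → Exp N → Set
Barycentre ws p = mass ws ≡ 1ℚ × (∀ i j → moment ws i j ≡ toℚ (p i j))

NonNegative : Weighted N → Set
NonNegative = All (λ (w , _) → 0ℚ ℚ.≤ w)

-- Points of weight zero may lie outside P, so that a weighting can be split
-- between two sets and checked against each.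
Charges : (Exp N → Set) → Weighted N → Set
Charges P = All (λ (w , a) → w ≡ 0ℚ ⊎ P a)

Rigid : (Exp N → Set) → Set
Rigid P = ∀ ws p → NonNegative ws → Charges P ws → Barycentre ws p → Charges (_≐ p) ws

charged-point : {P : Exp N → Set} (ws : Weighted N) → Charges P ws → mass ws ≡ 1ℚ → ∃ P
charged-point [] [] 0≡1 with () ← cong ℚ.↥_ 0≡1
charged-point ((_ , a) ∷ ws) (inj₂ Pa ∷ _) _ = a , Pa
charged-point ((w , _) ∷ ws) (inj₁ w≡0 ∷ ch) mass≡1 =
  charged-point ws ch (trans (sym (ℚ.+-identityˡ (mass ws))) (trans (cong (ℚ._+ mass ws) (sym w≡0)) mass≡1))

Rigid-⊆ : {P Q : Exp N → Set} → P ⊆ Q → Rigid Q → Rigid P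
Rigid-⊆ P⊆Q rigid ws p nonneg charges = rigid ws p nonneg (All.map (Sum.map₂ P⊆Q) charges)

Rigid-singleton : (e : Exp N) → Rigid (_≐ e)
Rigid-singleton e ws p _ charges (mass≡1 , moment≡p) =
  All.map (Sum.map₂ (λ a≐e i j → trans (a≐e i j) (e≐p i j))) charges
  where
  open ≡-Reasoning
  e≐p : e ≐ p
  e≐p i j = toℚ-injective (begin
    toℚ (e i j)                             ≡⟨ ℚ.*-identityˡ _ ⟨
    1ℚ ℚ.* toℚ (e i j)                      ≡⟨ cong (ℚ._* toℚ (e i j)) mass≡1 ⟨
    mass ws ℚ.* toℚ (e i j)                 ≡⟨ ∑-*ʳ ws proj₁ (toℚ (e i j)) ⟨
    ∑ ws (λ (w , _) → w ℚ.* toℚ (e i j))    ≡⟨ ∑-cong ws (All.map at-e charges) ⟩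
    moment ws i j                           ≡⟨ moment≡p i j ⟩
    toℚ (p i j)                             ∎)
    where
    at-e : ∀ {t} → proj₁ t ≡ 0ℚ ⊎ proj₂ t ≐ e → proj₁ t ℚ.* toℚ (e i j) ≡ proj₁ t ℚ.* toℚ (proj₂ t i j)
    at-e {w , a} (inj₁ w≡0) rewrite w≡0 = trans (ℚ.*-zeroˡ (toℚ (e i j))) (sym (ℚ.*-zeroˡ (toℚ (a i j))))
    at-e {w , a} (inj₂ a≐e) = cong (λ z → w ℚ.* toℚ z) (sym (a≐e i j))

Rigid-translate : {P : Exp N → Set} (t : Exp N) → Rigid P → Rigid (λ a → P (a ⊖ t))
Rigid-translate t rigid ws p nonneg charges (mass≡1 , moment≡p) =
  All.map (Sum.map₂ ⊖-cancelʳ) (All.map⁻ (rigid (map shift ws) (p ⊖ t) (All.map⁺ nonneg) (All.map⁺ charges)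
                                                (trans (∑-map shift ws proj₁) mass≡1 , moment-shift)))
  where
  open ≡-Reasoning
  shift : ℚ × Exp _ → ℚ × Exp _
  shift (w , a) = (w , a ⊖ t)
  moment-shift : ∀ i j → moment (map shift ws) i j ≡ toℚ ((p ⊖ t) i j)
  moment-shift i j = begin
    moment (map shift ws) i j
      ≡⟨ ∑-map shift ws (λ (w , a) → w ℚ.* toℚ (a i j)) ⟩
    ∑ ws (λ (w , a) → w ℚ.* toℚ (a i j ℤ.- t i j))
      ≡⟨ ∑-cong ws (All.tabulate λ {(w , a)} _ → distrib w (a i j)) ⟩
    ∑ ws (λ (w , a) → w ℚ.* toℚ (a i j) ℚ.- w ℚ.* toℚ (t i j))
      ≡⟨ ∑-‿ ws (λ (w , a) → w ℚ.* toℚ (a i j)) (λ (w , _) → w ℚ.* toℚ (t i j)) ⟩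
    moment ws i j ℚ.- ∑ ws (λ (w , _) → w ℚ.* toℚ (t i j))
      ≡⟨ cong (λ z → moment ws i j ℚ.- z) (∑-*ʳ ws proj₁ (toℚ (t i j))) ⟩
    moment ws i j ℚ.- mass ws ℚ.* toℚ (t i j)
      ≡⟨ cong₂ (λ x y → x ℚ.- y ℚ.* toℚ (t i j)) (moment≡p i j) mass≡1 ⟩
    toℚ (p i j) ℚ.- 1ℚ ℚ.* toℚ (t i j)
      ≡⟨ cong (λ z → toℚ (p i j) ℚ.- z) (ℚ.*-identityˡ (toℚ (t i j))) ⟩
    toℚ (p i j) ℚ.- toℚ (t i j)
      ≡⟨ toℚ-homo-‿ (p i j) (t i j) ⟨
    toℚ (p i j ℤ.- t i j) ∎
    where
    distrib : ∀ w x → w ℚ.* toℚ (x ℤ.- t i j) ≡ w ℚ.* toℚ x ℚ.- w ℚ.* toℚ (t i j)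
    distrib w x = begin
      w ℚ.* toℚ (x ℤ.- t i j)                       ≡⟨ cong (w ℚ.*_) (toℚ-homo-‿ x (t i j)) ⟩
      w ℚ.* (toℚ x ℚ.- toℚ (t i j))                 ≡⟨ ℚ.*-distribˡ-+ w (toℚ x) (ℚ.- toℚ (t i j)) ⟩
      w ℚ.* toℚ x ℚ.+ w ℚ.* (ℚ.- toℚ (t i j))
        ≡⟨ cong (w ℚ.* toℚ x ℚ.+_) (ℚ.neg-distribʳ-* w (toℚ (t i j))) ⟨
      w ℚ.* toℚ x ℚ.- w ℚ.* toℚ (t i j)             ∎

0≤z≤1⇒z≡0∨z≡1 : ∀ {z} → + 0 ℤ.≤ z → z ℤ.≤ + 1 → z ≡ + 0 ⊎ z ≡ + 1
0≤z≤1⇒z≡0∨z≡1 {+ 0} _ _ = inj₁ refl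
0≤z≤1⇒z≡0∨z≡1 {+ 1} _ _ = inj₂ refl
0≤z≤1⇒z≡0∨z≡1 {+ ℕ.suc (ℕ.suc _)} _ (ℤ.+≤+ (ℕ.s≤s ()))

Charges-from-∑≡0 : {R : Exp N → Set} (ws : Weighted N) (F : ℚ × Exp N → ℚ) → NonNegative ws →
                   All (λ (w , a) → (F (w , a) ≡ 0ℚ × (w ≡ 0ℚ ⊎ R a)) ⊎ F (w , a) ≡ w) ws →
                   ∑ ws F ≡ 0ℚ → Charges R ws
Charges-from-∑≡0 {R = R} ws F nonneg alternatives ∑≡0 =
  All.zipWith charge (alternatives , ∑-nonNeg-≡0 ws (All.zipWith 0≤F (nonneg , alternatives)) ∑≡0)
  where
  0≤F : ∀ {t} → 0ℚ ℚ.≤ proj₁ t × ((F t ≡ 0ℚ × (proj₁ t ≡ 0ℚ ⊎ R (proj₂ t))) ⊎ F t ≡ proj₁ t) → 0ℚ ℚ.≤ F t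
  0≤F (_ , inj₁ (F≡0 , _)) = ℚ.≤-reflexive (sym F≡0)
  0≤F (0≤w , inj₂ F≡w) = subst (0ℚ ℚ.≤_) (sym F≡w) 0≤w
  charge : ∀ {t} → ((F t ≡ 0ℚ × (proj₁ t ≡ 0ℚ ⊎ R (proj₂ t))) ⊎ F t ≡ proj₁ t) × F t ≡ 0ℚ →
           proj₁ t ≡ 0ℚ ⊎ R (proj₂ t)
  charge (inj₁ (_ , c) , _) = c
  charge (inj₂ F≡w , F≡0) = inj₁ (trans (sym F≡w) F≡0)

Rigid-⊎ : {P Q : Exp N → Set} (k l : Fin N) → (∀ {a} → P a → a k l ≡ + 1) → (∀ {a} → Q a → a k l ≡ + 0) →
          Rigid P → Rigid Q → Rigid (λ a → P a ⊎ Q a)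
Rigid-⊎ {P = P} {Q} k l P⇒1 Q⇒0 rigidP rigidQ ws p nonneg charges bary@(mass≡1 , moment≡p) =
  Sum.[ on-level-0 , on-level-1 ]′ (0≤z≤1⇒z≡0∨z≡1 (toℚ-cancel-≤ 0≤pkl) (toℚ-cancel-≤ pkl≤1))
  where
  open ≡-Reasoning
  height gap : ℚ × Exp _ → ℚ
  height (w , a) = w ℚ.* toℚ (a k l)
  gap t = proj₁ t ℚ.- height t
  Level : ℚ × Exp _ → Set
  Level (w , a) = (height (w , a) ≡ 0ℚ × (w ≡ 0ℚ ⊎ Q a)) ⊎ (height (w , a) ≡ w × (w ≡ 0ℚ ⊎ P a))
  classify : ∀ {t} → proj₁ t ≡ 0ℚ ⊎ (P (proj₂ t) ⊎ Q (proj₂ t)) → Level t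
  classify {w , a} (inj₁ w≡0)      =
    inj₁ (trans (cong (ℚ._* toℚ (a k l)) w≡0) (ℚ.*-zeroˡ (toℚ (a k l))) , inj₁ w≡0)
  classify {w , a} (inj₂ (inj₁ Pa)) = inj₂ (trans (cong (λ z → w ℚ.* toℚ z) (P⇒1 Pa)) (ℚ.*-identityʳ w) , inj₂ Pa)
  classify {w , a} (inj₂ (inj₂ Qa)) = inj₁ (trans (cong (λ z → w ℚ.* toℚ z) (Q⇒0 Qa)) (ℚ.*-zeroʳ w) , inj₂ Qa)
  levels : All Level ws
  levels = All.map classify charges
  height-alternatives : All (λ t → (height t ≡ 0ℚ × (proj₁ t ≡ 0ℚ ⊎ Q (proj₂ t))) ⊎ height t ≡ proj₁ t) ws
  height-alternatives = All.map (Sum.map₂ proj₁) levels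
  gap-alternatives : All (λ t → (gap t ≡ 0ℚ × (proj₁ t ≡ 0ℚ ⊎ P (proj₂ t))) ⊎ gap t ≡ proj₁ t) ws
  gap-alternatives = All.map flip levels
    where
    flip : ∀ {t} → Level t → (gap t ≡ 0ℚ × (proj₁ t ≡ 0ℚ ⊎ P (proj₂ t))) ⊎ gap t ≡ proj₁ t
    flip {w , _} (inj₁ (h≡0 , _)) = inj₂ (trans (cong (λ z → w ℚ.- z) h≡0) (ℚ.+-identityʳ w))
    flip {w , _} (inj₂ (h≡w , c)) = inj₁ (trans (cong (λ z → w ℚ.- z) h≡w) (ℚ.+-inverseʳ w) , c)
  bounds : ∀ {t} → 0ℚ ℚ.≤ proj₁ t × Level t → 0ℚ ℚ.≤ height t × height t ℚ.≤ proj₁ t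
  bounds (0≤w , inj₁ (h≡0 , _)) = ℚ.≤-reflexive (sym h≡0) , subst (ℚ._≤ _) (sym h≡0) 0≤w
  bounds (0≤w , inj₂ (h≡w , _)) = subst (0ℚ ℚ.≤_) (sym h≡w) 0≤w , ℚ.≤-reflexive h≡w
  0≤pkl : 0ℚ ℚ.≤ toℚ (p k l)
  0≤pkl = subst (0ℚ ℚ.≤_) (moment≡p k l) (∑-nonNeg ws (All.zipWith (proj₁ ∘ bounds) (nonneg , levels)))
  pkl≤1 : toℚ (p k l) ℚ.≤ 1ℚ
  pkl≤1 = subst₂ ℚ._≤_ (moment≡p k l) mass≡1 (∑-mono-≤ ws (All.zipWith (proj₂ ∘ bounds) (nonneg , levels)))
  on-level-0 : p k l ≡ + 0 → Charges (_≐ p) ws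
  on-level-0 pkl≡0 = rigidQ ws p nonneg
    (Charges-from-∑≡0 ws height nonneg height-alternatives (trans (moment≡p k l) (cong toℚ pkl≡0))) bary
  on-level-1 : p k l ≡ + 1 → Charges (_≐ p) ws
  on-level-1 pkl≡1 = rigidP ws p nonneg (Charges-from-∑≡0 ws gap nonneg gap-alternatives (begin
    ∑ ws gap                       ≡⟨ ∑-‿ ws proj₁ height ⟩
    mass ws ℚ.- moment ws k l      ≡⟨ cong₂ ℚ._-_ mass≡1 (trans (moment≡p k l) (cong toℚ pkl≡1)) ⟩
    1ℚ ℚ.- 1ℚ                      ≡⟨ ℚ.+-inverseʳ 1ℚ ⟩
    0ℚ                             ∎)) bary

Rigid-Supp⇒Saturated×Empty : (f : Laurent N) → Rigid (Supp f) → Saturated f × Empty f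
Rigid-Supp⇒Saturated×Empty f rigid = saturated , λ p p∈N → saturated p p∈N , not-in-hull-of-others p
  where
  concentrated : ∀ {P : Exp _ → Set} ws p → All (λ (w , a) → 0ℚ ℚ.≤ w × P a) ws → P ⊆ Supp f →
                 Barycentre ws p → Charges (_≐ p) ws
  concentrated ws p points P⊆supp bary =
    rigid ws p (All.map proj₁ points) (All.map (inj₂ ∘ P⊆supp ∘ proj₂) points) bary
  saturated : Saturated f
  saturated p (ws , points , bary@(mass≡1 , _)) =
    Supp-at-p (charged-point ws (All.zipWith in-support (points , concentrated ws p points id bary)) mass≡1)
    where
    Supp-at-p : ∃ (λ a → Supp f a × a ≐ p) → Supp f p
    Supp-at-p (a , a∈supp , a≐p) coeff≡0 = a∈supp (trans (coeff-cong f a≐p) coeff≡0)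
    in-support : ∀ {t} → (0ℚ ℚ.≤ proj₁ t × Supp f (proj₂ t)) × (proj₁ t ≡ 0ℚ ⊎ proj₂ t ≐ p) →
                 proj₁ t ≡ 0ℚ ⊎ (Supp f (proj₂ t) × proj₂ t ≐ p)
    in-support (_ , inj₁ w≡0) = inj₁ w≡0
    in-support ((_ , a∈supp) , inj₂ a≐p) = inj₂ (a∈supp , a≐p)
  not-in-hull-of-others : ∀ p → ¬ InConv (λ a → Supp f a × ¬ a ≐ p) p
  not-in-hull-of-others p (ws , points , bary@(mass≡1 , _)) =
    proj₂ (charged-point ws (All.zipWith nowhere (points , concentrated ws p points proj₁ bary)) mass≡1)
    where
    nowhere : ∀ {t} → (0ℚ ℚ.≤ proj₁ t × (Supp f (proj₂ t) × ¬ proj₂ t ≐ p)) × (proj₁ t ≡ 0ℚ ⊎ proj₂ t ≐ p) →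
              proj₁ t ≡ 0ℚ ⊎ ⊥
    nowhere (_ , inj₁ w≡0) = inj₁ w≡0
    nowhere ((_ , _ , a≉p) , inj₂ a≐p) = inj₂ (a≉p a≐p)

Rigid-exchange : {S₁ S₂ : Exp N → Set} (t₁ t₂ : Exp N) (k l : Fin N) → Rigid S₁ → Rigid S₂ →
                 (∀ {b} → S₁ b → b k l ≡ + 0) → (∀ {b} → S₂ b → b k l ≡ + 0) →
                 t₁ k l ≡ + 1 → t₂ k l ≡ + 0 → Rigid (λ a → S₁ (a ⊖ t₁) ⊎ S₂ (a ⊖ t₂))
Rigid-exchange t₁ t₂ k l rigid₁ rigid₂ S₁⇒0 S₂⇒0 t₁≡1 t₂≡0 =
  Rigid-⊎ k l (λ s → trans (ℤ.i-j≡0⇒i≡j _ _ (S₁⇒0 s)) t₁≡1) (λ s → trans (ℤ.i-j≡0⇒i≡j _ _ (S₂⇒0 s)) t₂≡0)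
    (Rigid-translate t₁ rigid₁) (Rigid-translate t₂ rigid₂)

-- Diagonals of a triangulated polygon

Cross-sym : Cross i j k l → Cross k l i j
Cross-sym (inj₁ c) = inj₂ c
Cross-sym (inj₂ c) = inj₁ c

¬Cross-sharingˡ : ¬ Cross i j i k
¬Cross-sharingˡ (inj₁ (i<i , _)) = <-irrefl refl i<i
¬Cross-sharingˡ (inj₂ (i<i , _)) = <-irrefl refl i<i

¬Cross-sharingʳ : ¬ Cross j i i k
¬Cross-sharingʳ (inj₁ (_ , i<i , _)) = <-irrefl refl i<i
¬Cross-sharingʳ (inj₂ (i<j , j<k , k<i)) = <-irrefl refl (<-trans i<j (<-trans j<k k<i))

nothing-between : ∀ {m n o} → m < n → n < o → suc m ≡ o → ⊥
nothing-between m<n n<o refl = <⇒≱ m<n (m<1+n⇒m≤n n<o)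

¬Cross-side : IsSide k l → ¬ Cross i j k l
¬Cross-side (inj₁ 1+k≡l) (inj₁ (_ , k<j , j<l)) = nothing-between k<j j<l 1+k≡l
¬Cross-side (inj₁ 1+k≡l) (inj₂ (k<i , i<l , _)) = nothing-between k<i i<l 1+k≡l
¬Cross-side (inj₂ (k≡0 , _)) (inj₁ (i<k , _)) = contradiction (subst (_ <_) k≡0 i<k) λ ()
¬Cross-side {j = j} (inj₂ (_ , 1+l≡N)) (inj₂ (_ , _ , l<j)) = nothing-between l<j (toℕ<n j) 1+l≡N

next-vertex : {u v : Fin N} → u <F v → ¬ IsSide u v → ∃[ B ] (u <F B × B <F v × IsSide u B)
next-vertex {u = u} {v} u<v uv-not-side =
  B , subst (toℕ u <_) (sym B≡1+u) ≤-refl , subst (_< toℕ v) (sym B≡1+u) 1+u<v , inj₁ (sym B≡1+u)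
  where
  1+u<v : suc (toℕ u) < toℕ v
  1+u<v = ≤∧≢⇒< u<v (λ 1+u≡v → uv-not-side (inj₁ 1+u≡v))
  B : Fin _
  B = fromℕ< (<-trans 1+u<v (toℕ<n v))
  B≡1+u : toℕ B ≡ suc (toℕ u)
  B≡1+u = toℕ-fromℕ< (<-trans 1+u<v (toℕ<n v))

previous-vertex : {u v : Fin N} → u <F v → ¬ IsSide u v → ∃[ D ] ((v <F D × IsSide u D) ⊎ (D <F u × IsSide D u))
previous-vertex {u = Fin.zero {n}} {v} _ uv-not-side =
  fromℕ n , inj₁ (v<n , inj₂ (refl , cong suc (toℕ-fromℕ n)))
  where
  v<n : v <F fromℕ n
  v<n = subst (toℕ v <_) (sym (toℕ-fromℕ n))
              (≤∧≢⇒< (m<1+n⇒m≤n (toℕ<n v)) λ v≡n → uv-not-side (inj₂ (refl , cong suc v≡n)))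
previous-vertex {u = Fin.suc u′} _ _ =
  inject₁ u′ , inj₂ (subst (_< suc (toℕ u′)) (sym (toℕ-inject₁ u′)) ≤-refl , inj₁ (cong suc (toℕ-inject₁ u′)))

<F⇒≢ : i <F j → i ≢ j
<F⇒≢ i<j refl = <-irrefl refl i<j

IsSide? : (i j : Fin N) → Dec (IsSide i j)
IsSide? {N} i j = suc (toℕ i) ℕ.≟ toℕ j ⊎-dec (toℕ i ℕ.≟ 0 ×-dec suc (toℕ j) ℕ.≟ N)

Cross? : (i j k l : Fin N) → Dec (Cross i j k l)
Cross? i j k l = (toℕ i <? toℕ k ×-dec toℕ k <? toℕ j ×-dec toℕ j <? toℕ l)
          ⊎-dec (toℕ k <? toℕ i ×-dec toℕ i <? toℕ l ×-dec toℕ l <? toℕ j)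

module _ {N : ℕ} (T : Triangulation N) where

  private
    variable
      u v x y : Fin N

  IsEdge : Fin N → Fin N → Set
  IsEdge i j = inT T i j ≡ true ⊎ IsSide i j

  ¬Cross-edge : {i j k l : Fin N} → IsEdge k l → inT T i j ≡ true → ¬ Cross i j k l
  ¬Cross-edge (inj₁ kl∈T) ij∈T = noncross T _ _ _ _ ij∈T kl∈T
  ¬Cross-edge (inj₂ side) _    = ¬Cross-side side

  ¬Cross-edge′ : {i j k l : Fin N} → IsEdge k l → inT T i j ≡ true → ¬ Cross k l i j
  ¬Cross-edge′ kl ij∈T = ¬Cross-edge kl ij∈T ∘ Cross-sym

  -- Two edges u B and u D on either side of u v, with B strictly between u and v
  -- and D after v (ᴵ) or before u (ᴵᴵ).  A closed wedge is the triangle of T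
  -- that u v enters at u.
  data Wedge (u v : Fin N) : Set where
    wedgeᴵ  : (B D : Fin N) → u <F B → B <F v → v <F D → IsEdge u B → IsEdge u D → Wedge u v
    wedgeᴵᴵ : (B D : Fin N) → D <F u → u <F B → B <F v → IsEdge u B → IsEdge D u → Wedge u v

  Closed : Wedge u v → Set
  Closed (wedgeᴵ B D _ _ _ _ _)  = inT T B D ≡ true
  Closed (wedgeᴵᴵ B D _ _ _ _ _) = inT T D B ≡ true

  width : Wedge u v → ℕ
  width (wedgeᴵ B D _ _ _ _ _)  = toℕ D ∸ toℕ B
  width (wedgeᴵᴵ B D _ _ _ _ _) = (N ∸ toℕ B) + toℕ D

  -- A diagonal of T crossing B D must leave u (it cannot cross u B or u D),
  -- and it then splits the wedge.
  narrowᴵ : {B D : Fin N} → inT T u v ≡ false → u <F B → B <F v → v <F D → IsEdge u B → IsEdge u D →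
            inT T B D ≡ false → Σ[ w ∈ Wedge u v ] width w < toℕ D ∸ toℕ B
  narrowᴵ {u = u} {v} {B} {D} uv∉T u<B B<v v<D uB uD BD∉T
    with maximal T B D (<-trans B<v v<D , BD-not-side) BD∉T
    where
    BD-not-side : ¬ IsSide B D
    BD-not-side (inj₁ 1+B≡D)      = nothing-between B<v v<D 1+B≡D
    BD-not-side (inj₂ (B≡0 , _)) = contradiction (subst (toℕ u <_) B≡0 u<B) λ ()
  ... | k , l , kl∈T , inj₁ (B<k , k<D , D<l) =
    contradiction (inj₁ (<-trans u<B B<k , k<D , D<l)) (¬Cross-edge′ uD kl∈T)
  ... | k , l , kl∈T , inj₂ (k<B , B<l , l<D) with <-cmp (toℕ k) (toℕ u)
  ...   | tri< k<u _ _ = contradiction (inj₁ (k<u , <-trans u<B B<l , l<D)) (¬Cross-edge uD kl∈T)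
  ...   | tri> _ _ u<k = contradiction (inj₁ (u<k , k<B , B<l)) (¬Cross-edge′ uB kl∈T)
  ...   | tri≈ _ k≡u _ with refl ← toℕ-injective k≡u with <-cmp (toℕ l) (toℕ v)
  ...     | tri< l<v _ _ = wedgeᴵ l D (<-trans u<B B<l) l<v v<D (inj₁ kl∈T) uD , ∸-monoʳ-< B<l (<⇒≤ l<D)
  ...     | tri≈ _ l≡v _ with refl ← toℕ-injective l≡v = contradiction (trans (sym kl∈T) uv∉T) λ ()
  ...     | tri> _ _ v<l = wedgeᴵ B l u<B B<v v<l uB (inj₁ kl∈T) , ∸-monoˡ-< l<D (<⇒≤ (<-trans B<v v<l))

  narrowᴵᴵ : {B D : Fin N} → inT T u v ≡ false → D <F u → u <F B → B <F v → IsEdge u B → IsEdge D u →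
             inT T D B ≡ false → Σ[ w ∈ Wedge u v ] width w < (N ∸ toℕ B) + toℕ D
  narrowᴵᴵ {u = u} {v} {B} {D} uv∉T D<u u<B B<v uB Du DB∉T
    with maximal T D B (<-trans D<u u<B , DB-not-side) DB∉T
    where
    DB-not-side : ¬ IsSide D B
    DB-not-side (inj₁ 1+D≡B)       = nothing-between D<u u<B 1+D≡B
    DB-not-side (inj₂ (_ , 1+B≡N)) = nothing-between B<v (toℕ<n v) 1+B≡N
  ... | k , l , kl∈T , inj₁ (D<k , k<B , B<l) with <-cmp (toℕ k) (toℕ u)
  ...   | tri< k<u _ _ = contradiction (inj₁ (D<k , k<u , <-trans u<B B<l)) (¬Cross-edge′ Du kl∈T)
  ...   | tri> _ _ u<k = contradiction (inj₁ (u<k , k<B , B<l)) (¬Cross-edge′ uB kl∈T)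
  ...   | tri≈ _ k≡u _ with refl ← toℕ-injective k≡u with <-cmp (toℕ l) (toℕ v)
  ...     | tri< l<v _ _ = wedgeᴵᴵ l D D<u (<-trans u<B B<l) l<v (inj₁ kl∈T) Du ,
                           +-monoˡ-< (toℕ D) (∸-monoʳ-< B<l (<⇒≤ (toℕ<n l)))
  ...     | tri≈ _ l≡v _ with refl ← toℕ-injective l≡v = contradiction (trans (sym kl∈T) uv∉T) λ ()
  ...     | tri> _ _ v<l = wedgeᴵ B l u<B B<v v<l uB (inj₁ kl∈T) ,
                           <-≤-trans (∸-monoˡ-< (toℕ<n l) (<⇒≤ (<-trans B<v v<l))) (m≤m+n (N ∸ toℕ B) (toℕ D))
  narrowᴵᴵ {u = u} {v} {B} {D} uv∉T D<u u<B B<v uB Du DB∉T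
      | k , l , kl∈T , inj₂ (k<D , D<l , l<B) with <-cmp (toℕ l) (toℕ u)
  ... | tri< l<u _ _ = contradiction (inj₁ (k<D , D<l , l<u)) (¬Cross-edge Du kl∈T)
  ... | tri> _ _ u<l = contradiction (inj₁ (<-trans k<D D<u , u<l , l<B)) (¬Cross-edge uB kl∈T)
  ... | tri≈ _ l≡u _ with refl ← toℕ-injective l≡u =
    wedgeᴵᴵ B k (<-trans k<D D<u) u<B B<v uB (inj₁ kl∈T) , +-monoʳ-< (N ∸ toℕ B) k<D

  close-or-narrow : inT T u v ≡ false → (w : Wedge u v) → Closed w ⊎ Σ[ w′ ∈ Wedge u v ] width w′ < width w
  close-or-narrow uv∉T (wedgeᴵ B D u<B B<v v<D uB uD) with inT T B D in BD
  ... | true  = inj₁ refl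
  ... | false = inj₂ (narrowᴵ uv∉T u<B B<v v<D uB uD BD)
  close-or-narrow uv∉T (wedgeᴵᴵ B D D<u u<B B<v uB Du) with inT T D B in DB
  ... | true  = inj₁ refl
  ... | false = inj₂ (narrowᴵᴵ uv∉T D<u u<B B<v uB Du DB)

  closed-wedge : u <F v → ¬ IsSide u v → inT T u v ≡ false → Σ (Wedge u v) Closed
  closed-wedge u<v uv-not-side uv∉T = shrink initial (<-wellFounded (width initial))
    where
    initial : Wedge _ _
    initial with next-vertex u<v uv-not-side | previous-vertex u<v uv-not-side
    ... | B , u<B , B<v , uB | D , inj₁ (v<D , uD) = wedgeᴵ B D u<B B<v v<D (inj₂ uB) (inj₂ uD)
    ... | B , u<B , B<v , uB | D , inj₂ (D<u , Du) = wedgeᴵᴵ B D D<u u<B B<v (inj₂ uB) (inj₂ Du)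
    shrink : (w : Wedge _ _) → Acc _<_ (width w) → Σ (Wedge _ _) Closed
    shrink w (acc smaller) with close-or-narrow uv∉T w
    ... | inj₁ closed     = w , closed
    ... | inj₂ (w′ , w′<w) = shrink w′ (smaller w′<w)

  Crossings : Fin N → Fin N → Rel (Fin N) 0ℓ
  Crossings x y k l = inT T k l ≡ true × Cross k l x y

  Involved : Fin N → Fin N → Pred (Fin N) 0ℓ
  Involved x y k = k ≡ x ⊎ k ≡ y ⊎ ∃[ m ] (Crossings x y k m ⊎ Crossings x y m k)

  crossing-involved : {k l : Fin N} → Crossings x y k l → Involved x y k × Involved x y l
  crossing-involved c = inj₂ (inj₂ (_ , inj₁ c)) , inj₂ (inj₂ (_ , inj₂ c))

  Crossings? : (x y k l : Fin N) → Dec (Crossings x y k l)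
  Crossings? x y k l = (inT T k l Bool.≟ true) ×-dec Cross? k l x y

  Involved? : (x y k : Fin N) → Dec (Involved x y k)
  Involved? x y k = k Fin.≟ x ⊎-dec k Fin.≟ y ⊎-dec any? λ m → Crossings? x y k m ⊎-dec Crossings? x y m k

  involved : Fin N → Fin N → Subset N
  involved x y = tabulate (λ k → does (Involved? x y k))

  ∈-involved : {k : Fin N} → Involved x y k → k ∈ involved x y
  ∈-involved {x = x} {y} {k} inv =
    lookup⇒[]= k _ (trans (lookup∘tabulate _ k) (dec-true (Involved? x y k) inv))

  ∈-involved⁻¹ : {k : Fin N} → k ∈ involved x y → Involved x y k
  ∈-involved⁻¹ {x = x} {y} {k} k∈ = decidable-stable (Involved? x y k) λ ¬inv →
    contradiction (trans (sym ([]=⇒lookup k∈)) (trans (lookup∘tabulate _ k) (dec-false (Involved? x y k) ¬inv)))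
                  λ ()

  record Reduces (c d x y : Fin N) : Set where
    field
      crossings  : Crossings c d ⇒ Crossings x y
      c-involved : Involved x y c
      d-involved : Involved x y d
      x≢c        : x ≢ c
      x≢d        : x ≢ d

  module _ {c d : Fin N} (r : Reduces c d x y) where
    open Reduces r

    Involved-reduces : Involved c d ⊆ Involved x y
    Involved-reduces (inj₁ refl)                 = c-involved
    Involved-reduces (inj₂ (inj₁ refl))          = d-involved
    Involved-reduces (inj₂ (inj₂ (m , inj₁ km))) = inj₂ (inj₂ (m , inj₁ (crossings km)))
    Involved-reduces (inj₂ (inj₂ (m , inj₂ mk))) = inj₂ (inj₂ (m , inj₂ (crossings mk)))

    uninvolved-reduces : ¬ Involved c d x
    uninvolved-reduces (inj₁ x≡c)                        = x≢c x≡c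
    uninvolved-reduces (inj₂ (inj₁ x≡d))                 = x≢d x≡d
    uninvolved-reduces (inj₂ (inj₂ (m , inj₁ xm)))    = ¬Cross-sharingˡ (proj₂ (crossings xm))
    uninvolved-reduces (inj₂ (inj₂ (m , inj₂ mx)))    = ¬Cross-sharingʳ (proj₂ (crossings mx))

    involved-⊂ : involved c d ⊂ involved x y
    involved-⊂ = (λ k∈cd → ∈-involved (Involved-reduces (∈-involved⁻¹ k∈cd))) ,
                 x , ∈-involved (inj₁ refl) , uninvolved-reduces ∘ ∈-involved⁻¹

  reducesᴵ : {B D : Fin N} → x <F B → B <F y → y <F D → inT T B D ≡ true → Reduces y D x y × Reduces B y x y
  reducesᴵ {x = x} {y} {B} {D} x<B B<y y<D BD∈T =
    record { crossings = crossings-yD ; c-involved = inj₂ (inj₁ refl) ; d-involved = proj₂ (crossing-involved BD)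
           ; x≢c = <F⇒≢ x<y ; x≢d = <F⇒≢ (<-trans x<y y<D) } ,
    record { crossings = crossings-By ; c-involved = proj₁ (crossing-involved BD) ; d-involved = inj₂ (inj₁ refl)
           ; x≢c = <F⇒≢ x<B ; x≢d = <F⇒≢ x<y }
    where
    x<y : x <F y
    x<y = <-trans x<B B<y
    BD : Crossings x y B D
    BD = BD∈T , inj₂ (x<B , B<y , y<D)
    crossings-yD : Crossings y D ⇒ Crossings x y
    crossings-yD {k} (kl∈T , inj₁ (k<y , y<l , l<D)) with toℕ k <? toℕ B
    ... | yes k<B = contradiction (inj₁ (k<B , <-trans B<y y<l , l<D)) (noncross T _ _ _ _ kl∈T BD∈T)
    ... | no k≮B  = kl∈T , inj₂ (<-≤-trans x<B (≮⇒≥ k≮B) , k<y , y<l)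
    crossings-yD (kl∈T , inj₂ (y<k , k<D , D<l)) =
      contradiction (inj₂ (<-trans B<y y<k , k<D , D<l)) (noncross T _ _ _ _ kl∈T BD∈T)
    crossings-By : Crossings B y ⇒ Crossings x y
    crossings-By (kl∈T , inj₁ (k<B , B<l , l<y)) =
      contradiction (inj₁ (k<B , B<l , <-trans l<y y<D)) (noncross T _ _ _ _ kl∈T BD∈T)
    crossings-By (kl∈T , inj₂ (B<k , k<y , y<l)) = kl∈T , inj₂ (<-trans x<B B<k , k<y , y<l)

  reducesᴵᴵ : {B D : Fin N} → D <F x → x <F B → B <F y → inT T D B ≡ true → Reduces B y x y × Reduces D y x y
  reducesᴵᴵ {x = x} {y} {B} {D} D<x x<B B<y DB∈T =
    record { crossings = crossings-By ; c-involved = proj₂ (crossing-involved DB) ; d-involved = inj₂ (inj₁ refl)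
           ; x≢c = <F⇒≢ x<B ; x≢d = <F⇒≢ x<y } ,
    record { crossings = crossings-Dy ; c-involved = proj₁ (crossing-involved DB) ; d-involved = inj₂ (inj₁ refl)
           ; x≢c = <F⇒≢ D<x ∘ sym ; x≢d = <F⇒≢ x<y }
    where
    x<y : x <F y
    x<y = <-trans x<B B<y
    DB : Crossings x y D B
    DB = DB∈T , inj₁ (D<x , x<B , B<y)
    crossings-By : Crossings B y ⇒ Crossings x y
    crossings-By {k} (kl∈T , inj₁ (k<B , B<l , l<y)) with toℕ k <? toℕ x
    ... | yes k<x = kl∈T , inj₁ (k<x , <-trans x<B B<l , l<y)
    ... | no k≮x  = contradiction (inj₁ (<-≤-trans D<x (≮⇒≥ k≮x) , k<B , B<l)) (noncross T _ _ _ _ DB∈T kl∈T)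
    crossings-By (kl∈T , inj₂ (B<k , k<y , y<l)) = kl∈T , inj₂ (<-trans x<B B<k , k<y , y<l)
    crossings-Dy : Crossings D y ⇒ Crossings x y
    crossings-Dy {k} {l} (kl∈T , inj₁ (k<D , D<l , l<y)) with toℕ x <? toℕ l
    ... | yes x<l = kl∈T , inj₁ (<-trans k<D D<x , x<l , l<y)
    ... | no x≮l  = contradiction (inj₁ (k<D , D<l , ≤-<-trans (≮⇒≥ x≮l) x<B)) (noncross T _ _ _ _ kl∈T DB∈T)
    crossings-Dy {k} (kl∈T , inj₂ (D<k , k<y , y<l)) with toℕ x <? toℕ k
    ... | yes x<k = kl∈T , inj₂ (x<k , k<y , y<l)
    ... | no x≮k  = contradiction (inj₁ (D<k , ≤-<-trans (≮⇒≥ x≮k) x<B , <-trans B<y y<l))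
                                  (noncross T _ _ _ _ DB∈T kl∈T)

-- Laurent expansions of the cluster variables

module _ {N : ℕ} (T : Triangulation N) (L : Fin N → Fin N → Laurent N) (expansion : IsExpansion T L) where

  private
    seed : ∀ i j → InSeed T i j → L i j ≈L var i j
    seed = proj₁ expansion
    ptolemy : ∀ (A B C D : Fin N) → A <F B → B <F C → C <F D →
              (L A C *L L B D) ≈L ((L A B *L L C D) +L (L A D *L L B C))
    ptolemy = proj₂ expansion

  Local : Fin N → Fin N → Set
  Local x y = ∀ {a} → Supp (L x y) a → VerticesIn (Involved T x y) a

  Good : Fin N → Fin N → Set
  Good x y = Rigid (Supp (L x y)) × Local x y

  Good-edge : {x y : Fin N} → x <F y → IsEdge T x y → Good x y
  Good-edge {x} {y} x<y xy =
    Rigid-⊆ ≐basis (Rigid-singleton (basis x y)) ,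
    λ a∈supp → VerticesIn-cong (≐basis a∈supp) (VerticesIn-basis (inj₁ refl) (inj₂ (inj₁ refl)))
    where
    ≐basis : ∀ {a} → Supp (L x y) a → a ≐ basis x y
    ≐basis a∈supp = Supp-var (λ var≡0 → a∈supp (trans (seed x y (x<y , xy) _) var≡0))

  -- The seed variable at (k , l) occurs only in the first exchange term and in
  -- neither smaller expansion, so it separates the two shifted supports.
  Good-step : {x y c₁ d₁ c₂ d₂ k l : Fin N} {t₁ t₂ : Exp N} →
              Reduces T c₁ d₁ x y → Reduces T c₂ d₂ x y → Good c₁ d₁ → Good c₂ d₂ →
              (∀ {a} → Supp (L x y) a → Supp (L c₁ d₁) (a ⊖ t₁) ⊎ Supp (L c₂ d₂) (a ⊖ t₂)) →
              k ≡ x ⊎ l ≡ x → t₁ k l ≡ + 1 → t₂ k l ≡ + 0 →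
              VerticesIn (Involved T x y) t₁ → VerticesIn (Involved T x y) t₂ → Good x y
  Good-step {x} {y} {k = k} {l} {t₁} {t₂} r₁ r₂ (rigid₁ , local₁) (rigid₂ , local₂) cover
            x∈kl t₁≡1 t₂≡0 t₁-local t₂-local =
    Rigid-⊆ cover (Rigid-exchange t₁ t₂ k l rigid₁ rigid₂ (vanishes r₁ local₁) (vanishes r₂ local₂) t₁≡1 t₂≡0) ,
    λ a∈supp → Sum.[ shifted r₁ local₁ t₁-local , shifted r₂ local₂ t₂-local ]′ (cover a∈supp)
    where
    vanishes : ∀ {c d} → Reduces T c d x y → Local c d → ∀ {b} → Supp (L c d) b → b k l ≡ + 0
    vanishes {c} {d} r local b∈supp = VerticesIn-zero (local b∈supp) k l (Sum.map outside outside x∈kl)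
      where
      outside : ∀ {m} → m ≡ x → ¬ Involved T c d m
      outside refl = uninvolved-reduces T r
    shifted : ∀ {c d t a} → Reduces T c d x y → Local c d →
              VerticesIn (Involved T x y) t → Supp (L c d) (a ⊖ t) → VerticesIn (Involved T x y) a
    shifted {t = t} {a} r local t-local a-t∈supp =
      VerticesIn-cong (λ i j → sym (⊖-⊕-cancel a t i j))
        (VerticesIn-⊕ (VerticesIn-⊆ (Involved-reduces T r) (local a-t∈supp)) t-local)

  Good-closed-wedge : {x y : Fin N} (w : Wedge T x y) → Closed T w →
                      (∀ {c d} → Reduces T c d x y → c <F d → Good c d) → Good x y
  Good-closed-wedge {x} {y} (wedgeᴵ B D x<B B<y y<D xB xD) BD∈T good-smaller =
    Good-step {k = x} {B} r-yD r-By (good-smaller r-yD y<D) (good-smaller r-By B<y) cover (inj₁ refl)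
      (cong₂ ℤ._-_ (basis-diag x B) (basis-offˡ x≢B B))
      (cong₂ ℤ._-_ (basis-offʳ (<F⇒≢ B<D) x) (basis-offˡ x≢B B))
      (VerticesIn-⊖ (VerticesIn-basis x-involved B-involved) BD-local)
      (VerticesIn-⊖ (VerticesIn-basis x-involved D-involved) BD-local)
    where
    r-yD : Reduces T y D x y
    r-yD = proj₁ (reducesᴵ T x<B B<y y<D BD∈T)
    r-By : Reduces T B y x y
    r-By = proj₂ (reducesᴵ T x<B B<y y<D BD∈T)
    x≢B : x ≢ B
    x≢B = <F⇒≢ x<B
    B<D : B <F D
    B<D = <-trans B<y y<D
    x-involved : Involved T x y x
    x-involved = inj₁ refl
    B-involved : Involved T x y B
    B-involved = Reduces.c-involved r-By
    D-involved : Involved T x y D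
    D-involved = Reduces.d-involved r-yD
    BD-local : VerticesIn (Involved T x y) (basis B D)
    BD-local = VerticesIn-basis B-involved D-involved
    cover : ∀ {a} → Supp (L x y) a →
            Supp (L y D) (a ⊖ (basis x B ⊖ basis B D)) ⊎ Supp (L B y) (a ⊖ (basis x D ⊖ basis B D))
    cover = Supp-exchange (L x y) (L B D) (L x B) (L y D) (L x D) (L B y) (ptolemy x B y D x<B B<y y<D)
              (seed B D (B<D , inj₁ BD∈T)) (seed x B (x<B , xB)) (seed x D (<-trans x<B B<D , xD))
  Good-closed-wedge {x} {y} (wedgeᴵᴵ B D D<x x<B B<y xB Dx) DB∈T good-smaller =
    Good-step {k = D} {x} r-By r-Dy (good-smaller r-By B<y) (good-smaller r-Dy (<-trans D<x x<y))
      cover (inj₂ refl)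
      (cong₂ ℤ._-_ (basis-diag D x) (basis-offʳ x≢B D))
      (cong₂ ℤ._-_ (basis-offˡ (<F⇒≢ D<x) x) (basis-offʳ x≢B D))
      (VerticesIn-⊖ (VerticesIn-basis D-involved x-involved) DB-local)
      (VerticesIn-⊖ (VerticesIn-basis x-involved B-involved) DB-local)
    where
    r-By : Reduces T B y x y
    r-By = proj₁ (reducesᴵᴵ T D<x x<B B<y DB∈T)
    r-Dy : Reduces T D y x y
    r-Dy = proj₂ (reducesᴵᴵ T D<x x<B B<y DB∈T)
    x<y : x <F y
    x<y = <-trans x<B B<y
    x≢B : x ≢ B
    x≢B = <F⇒≢ x<B
    x-involved : Involved T x y x
    x-involved = inj₁ refl
    B-involved : Involved T x y B
    B-involved = Reduces.c-involved r-By
    D-involved : Involved T x y D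
    D-involved = Reduces.c-involved r-Dy
    DB-local : VerticesIn (Involved T x y) (basis D B)
    DB-local = VerticesIn-basis D-involved B-involved
    exchange : (L x y *L L D B) ≈L ((L D x *L L B y) +L (L x B *L L D y))
    exchange a = trans (*L-comm (L x y) (L D B) a)
                   (trans (ptolemy D x B y D<x x<B B<y a) (+L-congʳ (L D x *L L B y) (*L-comm (L D y) (L x B)) a))
    cover : ∀ {a} → Supp (L x y) a →
            Supp (L B y) (a ⊖ (basis D x ⊖ basis D B)) ⊎ Supp (L D y) (a ⊖ (basis x B ⊖ basis D B))
    cover = Supp-exchange (L x y) (L D B) (L D x) (L B y) (L x B) (L D y) exchange
              (seed D B (<-trans D<x x<B , inj₁ DB∈T)) (seed D x (D<x , Dx)) (seed x B (x<B , xB))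

  good : (x y : Fin N) → x <F y → Acc _⊂_ (involved T x y) → Good x y
  good x y x<y (acc smaller) with (inT T x y Bool.≟ true) ⊎-dec IsSide? x y
  ... | yes xy = Good-edge x<y xy
  ... | no ¬xy with w , closed ← closed-wedge T x<y (¬xy ∘ inj₂) (¬-not (¬xy ∘ inj₁)) =
    Good-closed-wedge w closed λ r c<d → good _ _ c<d (smaller (involved-⊂ T r))

  Saturated×Empty : {i j : Fin N} → IsDiagonal i j → Saturated (L i j) × Empty (L i j)
  Saturated×Empty {i} {j} (i<j , _) =
    Rigid-Supp⇒Saturated×Empty (L i j) (proj₁ (good i j i<j (⊂-wellFounded (involved T i j))))

theorem4p2 : (n : ℕ) → n ≥ 1 → (T : Triangulation (n + 3)) →
    (L : Fin (n + 3) → Fin (n + 3) → Laurent (n + 3)) → IsExpansion T L →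
    (i j : Fin (n + 3)) → IsDiagonal i j →
    Saturated (L i j) × Empty (L i j)
theorem4p2 n _ T L expansion i j ij = Saturated×Empty T L expansion ij
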